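{- Let $\mathcal V$ be a variety of Heyting algebras containing the Heyting algebra $\mathbf 2^2\oplus\mathbf 1$. Then the Heyting algebra $\mathbf 2^2$ does not embed into the free algebra $\mathbf F$ for $\mathcal V$ of countably infinite rank.
   Context: A Heyting algebra is a bounded lattice with a binary operation $\Rightarrow$ such that $a\wedge c\le b$ iff $c\le a\Rightarrow b$. $\mathbf 2^2$ is the four-element Boolean algebra regarded as a Heyting algebra. $\mathbf 2^2\oplus\mathbf 1$ is the five-element Heyting algebra whose lattice is the four-element Boolean lattice with a new top element added above its top (so it has two atoms $a,\neg a$, a coatom $a\vee\neg a$, and top $1$); its Heyting implication is the unique one determined by the lattice order. -}

module Defs where

open import Level using (0ℓ)
open import Data.Nat using (ℕ)
open import Data.Bool using (Bool; true; false; T; if_then_else_; not)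
  renaming (_∧_ to _&&_; _∨_ to _||_)
open import Data.Unit using (tt)
open import Data.Product using (_×_; _,_; proj₁; proj₂)
open import Relation.Binary.PropositionalEquality using (_≡_; refl; isEquivalence; subst)
open import Relation.Binary.Lattice using (HeytingAlgebra)
open import Relation.Nullary using (¬_)

data Term : Set where
  var  : ℕ → Term
  ⊤ₜ   : Term
  ⊥ₜ   : Term
  _∧ₜ_ : Term → Term → Term
  _∨ₜ_ : Term → Term → Term
  _⇒ₜ_ : Term → Term → Term

module _ (H : HeytingAlgebra 0ℓ 0ℓ 0ℓ) where
  open HeytingAlgebra H

  ⟦_⟧ : Term → (ℕ → Carrier) → Carrier
  ⟦ var i ⟧   ρ = ρ i
  ⟦ ⊤ₜ ⟧      ρ = ⊤
  ⟦ ⊥ₜ ⟧      ρ = ⊥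
  ⟦ s ∧ₜ t ⟧  ρ = ⟦ s ⟧ ρ ∧ ⟦ t ⟧ ρ
  ⟦ s ∨ₜ t ⟧  ρ = ⟦ s ⟧ ρ ∨ ⟦ t ⟧ ρ
  ⟦ s ⇒ₜ t ⟧  ρ = ⟦ s ⟧ ρ ⇨ ⟦ t ⟧ ρ

-- A variety of Heyting algebras is given (Birkhoff) by a set E of
-- equations s ≈ t between terms; its members are the Heyting algebras
-- satisfying every equation of E.

Equations : Set₁
Equations = Term → Term → Set

_⊨_ : HeytingAlgebra 0ℓ 0ℓ 0ℓ → Equations → Set
H ⊨ E = ∀ s t → E s t → ∀ (ρ : ℕ → HeytingAlgebra.Carrier H) →
        HeytingAlgebra._≈_ H (⟦ H ⟧ s ρ) (⟦ H ⟧ t ρ)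

_∈V_ : HeytingAlgebra 0ℓ 0ℓ 0ℓ → Equations → Set
H ∈V E = H ⊨ E

-- The free algebra F of V(E) of countably infinite rank: the term
-- algebra on the generators var 0, var 1, … modulo the equations valid
-- in every member of V(E).  We represent it as terms with this
-- equality ≈F.

_≈F[_]_ : Term → Equations → Term → Set₁
s ≈F[ E ] t = ∀ (H : HeytingAlgebra 0ℓ 0ℓ 0ℓ) → H ∈V E →
              ∀ (ρ : ℕ → HeytingAlgebra.Carrier H) →
              HeytingAlgebra._≈_ H (⟦ H ⟧ s ρ) (⟦ H ⟧ t ρ)

record EmbedsIntoFree (E : Equations) (B : HeytingAlgebra 0ℓ 0ℓ 0ℓ) : Set₁ where
  open HeytingAlgebra B
  field
    f      : Carrier → Term
    f-cong : ∀ {x y} → x ≈ y → f x ≈F[ E ] f y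
    f-∧    : ∀ x y → f (x ∧ y) ≈F[ E ] (f x ∧ₜ f y)
    f-∨    : ∀ x y → f (x ∨ y) ≈F[ E ] (f x ∨ₜ f y)
    f-⇨    : ∀ x y → f (x ⇨ y) ≈F[ E ] (f x ⇒ₜ f y)
    f-⊤    : f ⊤ ≈F[ E ] ⊤ₜ
    f-⊥    : f ⊥ ≈F[ E ] ⊥ₜ
    f-inj  : ∀ {x y} → f x ≈F[ E ] f y → x ≈ y

-- Finite Heyting algebras given by Boolean tables; all the Heyting
-- algebra laws are checked by computation.

private
  T-fst : ∀ a {b} → T (a && b) → T a
  T-fst true p = tt
  T-snd : ∀ a {b} → T (a && b) → T b
  T-snd true p = p
  T-imp : ∀ a {b} → T (not a || b) → T a → T b
  T-imp true p _ = p
  _⇒b_ : Bool → Bool → Bool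
  a ⇒b b = not a || b

module FiniteHA
  (A : Set)
  (all : (A → Bool) → Bool)
  (all-sound : ∀ p → T (all p) → ∀ x → T (p x))
  (eqb : A → A → Bool)
  (eqb-sound : ∀ x y → T (eqb x y) → x ≡ y)
  (leq : A → A → Bool)
  (join meet imp : A → A → A)
  (top bot : A)
  where

  private
    all2 : (A → A → Bool) → Bool
    all2 p = all (λ x → all (λ y → p x y))
    all3 : (A → A → A → Bool) → Bool
    all3 p = all (λ x → all2 (p x))
    s2 : ∀ p → T (all2 p) → ∀ x y → T (p x y)
    s2 p h x y = all-sound _ (all-sound _ h x) y
    s3 : ∀ p → T (all3 p) → ∀ x y z → T (p x y z)
    s3 p h x y z = s2 _ (all-sound _ h x) y z

    _≤_ : A → A → Set
    x ≤ y = T (leq x y)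

  build : T (all (λ x → leq x x))
        → T (all3 (λ x y z → (leq x y && leq y z) ⇒b leq x z))
        → T (all2 (λ x y → (leq x y && leq y x) ⇒b eqb x y))
        → T (all2 (λ x y → leq x (join x y)))
        → T (all2 (λ x y → leq y (join x y)))
        → T (all3 (λ x y z → (leq x z && leq y z) ⇒b leq (join x y) z))
        → T (all2 (λ x y → leq (meet x y) x))
        → T (all2 (λ x y → leq (meet x y) y))
        → T (all3 (λ x y z → (leq z x && leq z y) ⇒b leq z (meet x y)))
        → T (all (λ x → leq x top))
        → T (all (λ x → leq bot x))
        → T (all3 (λ w x y → leq (meet w x) y ⇒b leq w (imp x y)))
        → T (all3 (λ w x y → leq w (imp x y) ⇒b leq (meet w x) y))
        → HeytingAlgebra 0ℓ 0ℓ 0ℓ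
  build h₁ h₂ h₃ h₄ h₄' h₅ h₆ h₆' h₇ h₈ h₈' h₉ h₉' = record
    { Carrier = A ; _≈_ = _≡_ ; _≤_ = _≤_
    ; _∨_ = join ; _∧_ = meet ; _⇨_ = imp ; ⊤ = top ; ⊥ = bot
    ; isHeytingAlgebra = record
      { isBoundedLattice = record
        { isLattice = record
          { isPartialOrder = record
            { isPreorder = record
              { isEquivalence = isEquivalence
              ; reflexive = λ { {x} refl → all-sound _ h₁ x }
              ; trans = λ {x} {y} {z} p q →
                  T-imp (leq x y && leq y z) (s3 _ h₂ x y z) (pair p q) }
            ; antisym = λ {x} {y} p q →
                eqb-sound x y (T-imp (leq x y && leq y x) (s2 _ h₃ x y) (pair p q)) }
          ; supremum = λ x y →
              s2 _ h₄ x y , s2 _ h₄' x y ,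
              λ z p q → T-imp (leq x z && leq y z) (s3 _ h₅ x y z) (pair p q)
          ; infimum = λ x y →
              s2 _ h₆ x y , s2 _ h₆' x y ,
              λ z p q → T-imp (leq z x && leq z y) (s3 _ h₇ x y z) (pair p q) }
        ; maximum = λ x → all-sound _ h₈ x
        ; minimum = λ x → all-sound _ h₈' x }
      ; exponential = λ w x y →
          T-imp (leq (meet w x) y) (s3 _ h₉ w x y) ,
          T-imp (leq w (imp x y)) (s3 _ h₉' w x y) } }
    where
    pair : ∀ {a b} → T a → T b → T (a && b)
    pair {true} {true} _ _ = tt

-- 𝟐² : the four-element Boolean algebra {0, a, ¬a, 1}.

data Four : Set where
  f0 fa fna f1 : Four

private
  all4 : (Four → Bool) → Bool
  all4 p = p f0 && p fa && p fna && p f1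

  all4-sound : ∀ p → T (all4 p) → ∀ x → T (p x)
  all4-sound p h f0  = T-fst (p f0) h
  all4-sound p h fa  = T-fst (p fa) (T-snd (p f0) h)
  all4-sound p h fna = T-fst (p fna) (T-snd (p fa) (T-snd (p f0) h))
  all4-sound p h f1  = T-snd (p fna) (T-snd (p fa) (T-snd (p f0) h))

  eq4 : Four → Four → Bool
  eq4 f0 f0 = true
  eq4 fa fa = true
  eq4 fna fna = true
  eq4 f1 f1 = true
  eq4 _ _ = false

  eq4-sound : ∀ x y → T (eq4 x y) → x ≡ y
  eq4-sound f0 f0 _ = refl
  eq4-sound fa fa _ = refl
  eq4-sound fna fna _ = refl
  eq4-sound f1 f1 _ = refl

  leq4 : Four → Four → Bool
  leq4 f0 _ = true
  leq4 _ f1 = true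
  leq4 fa fa = true
  leq4 fna fna = true
  leq4 _ _ = false

  compl4 : Four → Four
  compl4 f0 = f1
  compl4 fa = fna
  compl4 fna = fa
  compl4 f1 = f0

  join4 : Four → Four → Four
  join4 x y = if leq4 x y then y else (if leq4 y x then x else f1)

  meet4 : Four → Four → Four
  meet4 x y = if leq4 x y then x else (if leq4 y x then y else f0)

  imp4 : Four → Four → Four
  imp4 x y = join4 (compl4 x) y

𝟐² : HeytingAlgebra 0ℓ 0ℓ 0ℓ
𝟐² = FiniteHA.build Four all4 all4-sound eq4 eq4-sound leq4
       join4 meet4 imp4 f1 f0 tt tt tt tt tt tt tt tt tt tt tt tt tt

-- 𝟐² ⊕ 𝟏 : the five-element Heyting algebra 0 < a, ¬a < a ∨ ¬a < 1.

data Five : Set where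
  g0 ga gna gc g1 : Five

private
  all5 : (Five → Bool) → Bool
  all5 p = p g0 && p ga && p gna && p gc && p g1

  all5-sound : ∀ p → T (all5 p) → ∀ x → T (p x)
  all5-sound p h g0  = T-fst (p g0) h
  all5-sound p h ga  = T-fst (p ga) (T-snd (p g0) h)
  all5-sound p h gna = T-fst (p gna) (T-snd (p ga) (T-snd (p g0) h))
  all5-sound p h gc  = T-fst (p gc) (T-snd (p gna) (T-snd (p ga) (T-snd (p g0) h)))
  all5-sound p h g1  = T-snd (p gc) (T-snd (p gna) (T-snd (p ga) (T-snd (p g0) h)))

  eq5 : Five → Five → Bool
  eq5 g0 g0 = true
  eq5 ga ga = true
  eq5 gna gna = true
  eq5 gc gc = true
  eq5 g1 g1 = true
  eq5 _ _ = false

  eq5-sound : ∀ x y → T (eq5 x y) → x ≡ y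
  eq5-sound g0 g0 _ = refl
  eq5-sound ga ga _ = refl
  eq5-sound gna gna _ = refl
  eq5-sound gc gc _ = refl
  eq5-sound g1 g1 _ = refl

  leq5 : Five → Five → Bool
  leq5 g0 _ = true
  leq5 _ g1 = true
  leq5 ga ga = true
  leq5 ga gc = true
  leq5 gna gna = true
  leq5 gna gc = true
  leq5 gc gc = true
  leq5 _ _ = false

  join5 : Five → Five → Five
  join5 x y = if leq5 x y then y else (if leq5 y x then x else gc)

  meet5 : Five → Five → Five
  meet5 x y = if leq5 x y then x else (if leq5 y x then y else g0)

  -- Heyting implication: 1 if x ≤ y, otherwise the largest z with z ∧ x ≤ y.
  imp5 : Five → Five → Five
  imp5 x y = if leq5 x y then g1 else table x y
    where
    table : Five → Five → Five
    table ga g0  = gna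
    table ga gna = gna
    table gna g0 = ga
    table gna ga = ga
    table gc g0  = g0
    table gc ga  = ga
    table gc gna = gna
    table g1 y   = y
    table _ _    = g0

𝟐²⊕𝟏 : HeytingAlgebra 0ℓ 0ℓ 0ℓ
𝟐²⊕𝟏 = FiniteHA.build Five all5 all5-sound eq5 eq5-sound leq5
         join5 meet5 imp5 g1 g0 tt tt tt tt tt tt tt tt tt tt tt tt tt

-- Suppose f embeds 𝟐² into F and let t = f a.  Then t ∨ ¬t = 1 holds in every member of
-- the variety.  In 𝟐²⊕𝟏 the only complemented elements are 0 and 1, and the two
-- homomorphisms 𝟐²⊕𝟏 → 𝟐 agree on them; valuating the variables of t by pairs of
-- classical truth values then shows that t is classically constant.  By Glivenko's
-- theorem a classical tautology is dense (¬¬-valid) in every Heyting algebra, and a dense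
-- complemented element is 1; so t = 1 in F if t is a tautology, and t = 0 in F if ¬t is
-- one.  Either way f is not injective.
module Submission where

open import Level using (0ℓ)
open import Data.Bool using (Bool; true; false; not; T) renaming (_∧_ to _&&_; _∨_ to _||_)
open import Data.Bool.Properties using (T-∧) renaming (_≟_ to _≟ᵇ_)
open import Data.Nat using (ℕ; zero; suc; _⊔_; z≤n) renaming (_≤_ to _≤ℕ_; _<_ to _<ℕ_)
open import Data.Nat.Properties using (_≟_; n<1+n; m<n⇒m<n⊔o; m<n⇒m<o⊔n; ≤∧≢⇒<; <⇒≱)
open import Data.Product using (_×_; _,_; proj₁; proj₂)
open import Data.Sum using (_⊎_; inj₁; inj₂; [_,_]′)
open import Data.Unit using (tt)
open import Function using (_∘_; Equivalence)
open import Relation.Binary.Lattice using (HeytingAlgebra)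
open import Relation.Binary.PropositionalEquality
  using (_≡_; _≢_; refl; sym; trans; cong; cong₂; subst; module ≡-Reasoning)
open import Relation.Nullary using (¬_; Dec; yes; no; contradiction)
open import Relation.Nullary.Decidable using (⌊_⌋; toWitness)

open import Defs

⟦_⟧ᵇ : Term → (ℕ → Bool) → Bool
⟦ var i ⟧ᵇ   b = b i
⟦ ⊤ₜ ⟧ᵇ      b = true
⟦ ⊥ₜ ⟧ᵇ      b = false
⟦ s ∧ₜ u ⟧ᵇ  b = ⟦ s ⟧ᵇ b && ⟦ u ⟧ᵇ b
⟦ s ∨ₜ u ⟧ᵇ  b = ⟦ s ⟧ᵇ b || ⟦ u ⟧ᵇ b
⟦ s ⇒ₜ u ⟧ᵇ  b = not (⟦ s ⟧ᵇ b) || ⟦ u ⟧ᵇ b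

Tautology : Term → Set
Tautology s = ∀ b → ⟦ s ⟧ᵇ b ≡ true

constant⇒tautology⊎refutable : ∀ s → (∀ b c → ⟦ s ⟧ᵇ b ≡ ⟦ s ⟧ᵇ c) →
                               Tautology s ⊎ Tautology (s ⇒ₜ ⊥ₜ)
constant⇒tautology⊎refutable s constant with ⟦ s ⟧ᵇ (λ _ → false) in eq
... | true  = inj₁ λ b → trans (constant b _) eq
... | false = inj₂ λ b → cong (λ v → not v || false) (trans (constant b _) eq)

varBound : Term → ℕ
varBound (var i)  = suc i
varBound ⊤ₜ       = 0
varBound ⊥ₜ       = 0
varBound (s ∧ₜ u) = varBound s ⊔ varBound u
varBound (s ∨ₜ u) = varBound s ⊔ varBound u
varBound (s ⇒ₜ u) = varBound s ⊔ varBound u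

module _ {P : ℕ → Set} (s u : Term) (h : ∀ i → i <ℕ varBound s ⊔ varBound u → P i) where

  restrictˡ : ∀ i → i <ℕ varBound s → P i
  restrictˡ i = h i ∘ m<n⇒m<n⊔o (varBound u)

  restrictʳ : ∀ i → i <ℕ varBound u → P i
  restrictʳ i = h i ∘ m<n⇒m<o⊔n (varBound s)

_[_≔_] : {A : Set} → (ℕ → A) → ℕ → A → ℕ → A
(σ [ k ≔ v ]) i with i ≟ k
... | yes _ = v
... | no  _ = σ i

module Pseudocomplement (H : HeytingAlgebra 0ℓ 0ℓ 0ℓ) where
  open HeytingAlgebra H renaming (refl to ≤-refl; trans to ≤-trans)
  open import Relation.Binary.Lattice.Properties.HeytingAlgebra H using (⇨-eval; x≤¬¬x)
  open import Relation.Binary.Lattice.Properties.MeetSemilattice meetSemilattice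
    using (∧-monotonic)

  Dense : Carrier → Set
  Dense x = x ⇨ ⊥ ≤ ⊥

  Complemented : Carrier → Set
  Complemented x = ⊤ ≤ x ∨ (x ⇨ ⊥)

  ⊤≤⇒dense : ∀ {x} → ⊤ ≤ x → Dense x
  ⊤≤⇒dense ⊤≤x = ≤-trans (∧-greatest ≤-refl (≤-trans (maximum _) ⊤≤x)) ⇨-eval

  complemented∧dense⇒⊤≤ : ∀ {x} → Complemented x → Dense x → ⊤ ≤ x
  complemented∧dense⇒⊤≤ compl dense = ≤-trans compl (∨-least ≤-refl (≤-trans dense (minimum _)))

  dense-¬⇒≤⊥ : ∀ {x} → Dense (x ⇨ ⊥) → x ≤ ⊥
  dense-¬⇒≤⊥ {x} dense = ≤-trans (x≤¬¬x x) dense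

  ¬-antitone-under : ∀ {c x y} → c ∧ y ≤ x → (x ⇨ ⊥) ∧ c ≤ y ⇨ ⊥
  ¬-antitone-under c∧y≤x = transpose-⇨
    (≤-trans (∧-greatest (≤-trans (x∧y≤x _ _) (x∧y≤x _ _))
                         (≤-trans (∧-monotonic (x∧y≤y _ _) ≤-refl) c∧y≤x))
             ⇨-eval)

  -- ¬x ≤ ¬a by the first case and ¬x ∧ ¬a ≤ ⊥ by the second, so ¬x ≤ ⊥.
  dense-by-cases : ∀ {a x y z} → a ∧ y ≤ x → (a ⇨ ⊥) ∧ z ≤ x →
                   Dense y → Dense z → Dense x
  dense-by-cases {a} {x} a∧y≤x ¬a∧z≤x dense-y dense-z =
    ≤-trans (∧-greatest ≤-refl ¬x≤¬a) (≤-trans (¬-antitone-under ¬a∧z≤x) dense-z)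
    where
    ¬x≤¬a : x ⇨ ⊥ ≤ a ⇨ ⊥
    ¬x≤¬a = transpose-⇨ (≤-trans (¬-antitone-under a∧y≤x) dense-y)

module Glivenko (H : HeytingAlgebra 0ℓ 0ℓ 0ℓ) where
  open HeytingAlgebra H renaming (refl to ≤-refl; trans to ≤-trans)
  open import Relation.Binary.Lattice.Properties.HeytingAlgebra H using (⇨-eval; ∧-distribˡ-∨-≤)
  open import Relation.Binary.Lattice.Properties.MeetSemilattice meetSemilattice
    using (∧-monotonic)
  open import Relation.Binary.Lattice.Properties.JoinSemilattice joinSemilattice
    using (∨-monotonic)
  open Pseudocomplement H

  ⌜_⌝ : Bool → Carrier
  ⌜ true ⌝  = ⊤
  ⌜ false ⌝ = ⊥

  _≈⌜_⌝ : Carrier → Bool → Set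
  x ≈⌜ true ⌝  = ⊤ ≤ x
  x ≈⌜ false ⌝ = x ≤ ⊥

  ⟦⟧-boolean : ∀ s b → ⟦ H ⟧ s (⌜_⌝ ∘ b) ≈⌜ ⟦ s ⟧ᵇ b ⌝
  ⟦⟧-boolean (var i) b with b i
  ... | true  = ≤-refl
  ... | false = ≤-refl
  ⟦⟧-boolean ⊤ₜ b = ≤-refl
  ⟦⟧-boolean ⊥ₜ b = ≤-refl
  ⟦⟧-boolean (s ∧ₜ u) b with ⟦ s ⟧ᵇ b | ⟦⟧-boolean s b | ⟦ u ⟧ᵇ b | ⟦⟧-boolean u b
  ... | true  | ⊤≤s | true  | ⊤≤u = ∧-greatest ⊤≤s ⊤≤u
  ... | true  | _   | false | u≤⊥ = ≤-trans (x∧y≤y _ _) u≤⊥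
  ... | false | s≤⊥ | _     | _   = ≤-trans (x∧y≤x _ _) s≤⊥
  ⟦⟧-boolean (s ∨ₜ u) b with ⟦ s ⟧ᵇ b | ⟦⟧-boolean s b | ⟦ u ⟧ᵇ b | ⟦⟧-boolean u b
  ... | true  | ⊤≤s | _     | _   = ≤-trans ⊤≤s (x≤x∨y _ _)
  ... | false | _   | true  | ⊤≤u = ≤-trans ⊤≤u (y≤x∨y _ _)
  ... | false | s≤⊥ | false | u≤⊥ = ∨-least s≤⊥ u≤⊥
  ⟦⟧-boolean (s ⇒ₜ u) b with ⟦ s ⟧ᵇ b | ⟦⟧-boolean s b | ⟦ u ⟧ᵇ b | ⟦⟧-boolean u b
  ... | false | s≤⊥ | _     | _   = transpose-⇨ (≤-trans (x∧y≤y _ _) (≤-trans s≤⊥ (minimum _)))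
  ... | true  | _   | true  | ⊤≤u = transpose-⇨ (≤-trans (maximum _) ⊤≤u)
  ... | true  | ⊤≤s | false | u≤⊥ =
    ≤-trans (∧-greatest ≤-refl (≤-trans (maximum _) ⊤≤s)) (≤-trans ⇨-eval u≤⊥)

  ⟦⟧-local : ∀ s {σ ρ} → (∀ i → i <ℕ varBound s → σ i ≡ ρ i) → ⟦ H ⟧ s σ ≡ ⟦ H ⟧ s ρ
  ⟦⟧-local (var i)  h = h i (n<1+n i)
  ⟦⟧-local ⊤ₜ       h = refl
  ⟦⟧-local ⊥ₜ       h = refl
  ⟦⟧-local (s ∧ₜ u) h = cong₂ _∧_ (⟦⟧-local s (restrictˡ s u h)) (⟦⟧-local u (restrictʳ s u h))
  ⟦⟧-local (s ∨ₜ u) h = cong₂ _∨_ (⟦⟧-local s (restrictˡ s u h)) (⟦⟧-local u (restrictʳ s u h))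
  ⟦⟧-local (s ⇒ₜ u) h = cong₂ _⇨_ (⟦⟧-local s (restrictˡ s u h)) (⟦⟧-local u (restrictʳ s u h))

  EqualBelow : Carrier → (ℕ → Carrier) → (ℕ → Carrier) → Set
  EqualBelow a σ σ′ = ∀ i → a ∧ σ i ≤ σ′ i × a ∧ σ′ i ≤ σ i

  EqualBelow-sym : ∀ {a σ σ′} → EqualBelow a σ σ′ → EqualBelow a σ′ σ
  EqualBelow-sym eq i = proj₂ (eq i) , proj₁ (eq i)

  EqualBelow-update : ∀ {a v} σ k → a ∧ v ≤ σ k → a ∧ σ k ≤ v → EqualBelow a (σ [ k ≔ v ]) σ
  EqualBelow-update σ k a∧v≤σk a∧σk≤v i with i ≟ k
  ... | yes refl = a∧v≤σk , a∧σk≤v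
  ... | no  _    = x∧y≤y _ _ , x∧y≤y _ _

  ⟦⟧-below : ∀ s {a σ σ′} → EqualBelow a σ σ′ → a ∧ ⟦ H ⟧ s σ ≤ ⟦ H ⟧ s σ′
  ⟦⟧-below (var i)  eq = proj₁ (eq i)
  ⟦⟧-below ⊤ₜ       eq = maximum _
  ⟦⟧-below ⊥ₜ       eq = x∧y≤y _ _
  ⟦⟧-below (s ∧ₜ u) eq =
    ∧-greatest (≤-trans (∧-monotonic ≤-refl (x∧y≤x _ _)) (⟦⟧-below s eq))
               (≤-trans (∧-monotonic ≤-refl (x∧y≤y _ _)) (⟦⟧-below u eq))
  ⟦⟧-below (s ∨ₜ u) {a} {σ} eq =
    ≤-trans (∧-distribˡ-∨-≤ a (⟦ H ⟧ s σ) (⟦ H ⟧ u σ))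
            (∨-monotonic (⟦⟧-below s eq) (⟦⟧-below u eq))
  ⟦⟧-below (s ⇒ₜ u) {a} {σ} {σ′} eq = transpose-⇨ (≤-trans a∧[s⇨u]∧s′≤a∧u (⟦⟧-below u eq))
    where
    a∧[s⇨u]∧s′≤a∧u : (a ∧ (⟦ H ⟧ s σ ⇨ ⟦ H ⟧ u σ)) ∧ ⟦ H ⟧ s σ′ ≤ a ∧ ⟦ H ⟧ u σ
    a∧[s⇨u]∧s′≤a∧u = ∧-greatest (≤-trans (x∧y≤x _ _) (x∧y≤x _ _))
      (≤-trans (∧-greatest (≤-trans (x∧y≤x _ _) (x∧y≤y _ _))
                           (≤-trans (∧-monotonic (x∧y≤x _ _) ≤-refl)
                                    (⟦⟧-below s (EqualBelow-sym eq))))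
               ⇨-eval)

  -- The step sets σ k to ⊤ and to ⊥ and recombines the two cases by dense-by-cases.
  tautology-dense-from : ∀ s → Tautology s → ∀ k (σ : ℕ → Carrier) (b : ℕ → Bool) →
                         (∀ i → k ≤ℕ i → i <ℕ varBound s → σ i ≡ ⌜ b i ⌝) →
                         Dense (⟦ H ⟧ s σ)
  tautology-dense-from s taut zero σ b boolean =
    ⊤≤⇒dense (subst (⊤ ≤_) (sym (⟦⟧-local s (λ i → boolean i z≤n)))
                   (subst (⟦ H ⟧ s (⌜_⌝ ∘ b) ≈⌜_⌝) (taut b) (⟦⟧-boolean s b)))
  tautology-dense-from s taut (suc k) σ b boolean =
    dense-by-cases {a = σ k}
      (⟦⟧-below s (EqualBelow-update σ k (x∧y≤x _ _) (maximum _)))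
      (⟦⟧-below s (EqualBelow-update σ k (≤-trans (x∧y≤y _ _) (minimum _)) ⇨-eval))
      (tautology-dense-from s taut k (σ [ k ≔ ⊤ ]) (b [ k ≔ true ]) (boolean-update true))
      (tautology-dense-from s taut k (σ [ k ≔ ⊥ ]) (b [ k ≔ false ]) (boolean-update false))
    where
    boolean-update : ∀ v i → k ≤ℕ i → i <ℕ varBound s → (σ [ k ≔ ⌜ v ⌝ ]) i ≡ ⌜ (b [ k ≔ v ]) i ⌝
    boolean-update v i k≤i i<bound with i ≟ k
    ... | yes _   = refl
    ... | no  i≢k = boolean i (≤∧≢⇒< k≤i (i≢k ∘ sym)) i<bound

  glivenko : ∀ s → Tautology s → ∀ ρ → Dense (⟦ H ⟧ s ρ)
  glivenko s taut ρ = tautology-dense-from s taut (varBound s) ρ (λ _ → false)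
                        (λ i bound≤i i<bound → contradiction bound≤i (<⇒≱ i<bound))

record HomTo𝟐 (H : HeytingAlgebra 0ℓ 0ℓ 0ℓ) : Set where
  open HeytingAlgebra H
  field
    ⟪_⟫   : Carrier → Bool
    hom-∧ : ∀ x y → ⟪ x ∧ y ⟫ ≡ ⟪ x ⟫ && ⟪ y ⟫
    hom-∨ : ∀ x y → ⟪ x ∨ y ⟫ ≡ ⟪ x ⟫ || ⟪ y ⟫
    hom-⇨ : ∀ x y → ⟪ x ⇨ y ⟫ ≡ not ⟪ x ⟫ || ⟪ y ⟫
    hom-⊤ : ⟪ ⊤ ⟫ ≡ true
    hom-⊥ : ⟪ ⊥ ⟫ ≡ false

module _ {H : HeytingAlgebra 0ℓ 0ℓ 0ℓ} (φ : HomTo𝟐 H) where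
  open HomTo𝟐 φ

  ⟦⟧-hom : ∀ s {ρ b} → (∀ i → ⟪ ρ i ⟫ ≡ b i) → ⟪ ⟦ H ⟧ s ρ ⟫ ≡ ⟦ s ⟧ᵇ b
  ⟦⟧-hom (var i)  h = h i
  ⟦⟧-hom ⊤ₜ       h = hom-⊤
  ⟦⟧-hom ⊥ₜ       h = hom-⊥
  ⟦⟧-hom (s ∧ₜ u) h = trans (hom-∧ _ _) (cong₂ _&&_ (⟦⟧-hom s h) (⟦⟧-hom u h))
  ⟦⟧-hom (s ∨ₜ u) h = trans (hom-∨ _ _) (cong₂ _||_ (⟦⟧-hom s h) (⟦⟧-hom u h))
  ⟦⟧-hom (s ⇒ₜ u) h = trans (hom-⇨ _ _) (cong₂ (λ x y → not x || y) (⟦⟧-hom s h) (⟦⟧-hom u h))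

module _ where
  open HeytingAlgebra 𝟐²⊕𝟏 using (_∧_; _∨_; _⇨_; ⊤; ⊥)

  every : (Five → Bool) → Bool
  every p = p g0 && p ga && p gna && p gc && p g1

  T-&&ˡ : ∀ x {y} → T (x && y) → T x
  T-&&ˡ x = proj₁ ∘ Equivalence.to (T-∧ {x})

  T-&&ʳ : ∀ x {y} → T (x && y) → T y
  T-&&ʳ x = proj₂ ∘ Equivalence.to (T-∧ {x})

  every-sound : ∀ p → T (every p) → ∀ x → T (p x)
  every-sound p h g0  = T-&&ˡ (p g0) h
  every-sound p h ga  = T-&&ˡ (p ga) (T-&&ʳ (p g0) h)
  every-sound p h gna = T-&&ˡ (p gna) (T-&&ʳ (p ga) (T-&&ʳ (p g0) h))
  every-sound p h gc  = T-&&ˡ (p gc) (T-&&ʳ (p gna) (T-&&ʳ (p ga) (T-&&ʳ (p g0) h)))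
  every-sound p h g1  = T-&&ʳ (p gc) (T-&&ʳ (p gna) (T-&&ʳ (p ga) (T-&&ʳ (p g0) h)))

  by-exhaustion : {P : Five → Five → Set} (P? : ∀ x y → Dec (P x y)) →
                  T (every λ x → every λ y → ⌊ P? x y ⌋) → ∀ x y → P x y
  by-exhaustion P? h x y =
    toWitness {a? = P? x y} (every-sound (λ y → ⌊ P? x y ⌋)
                           (every-sound (λ x → every λ y → ⌊ P? x y ⌋) h x) y)

  HomTo𝟐-by-exhaustion :
    (p : Five → Bool) →
    T (every λ x → every λ y → ⌊ p (x ∧ y) ≟ᵇ p x && p y ⌋) →
    T (every λ x → every λ y → ⌊ p (x ∨ y) ≟ᵇ p x || p y ⌋) →
    T (every λ x → every λ y → ⌊ p (x ⇨ y) ≟ᵇ not (p x) || p y ⌋) →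
    p ⊤ ≡ true → p ⊥ ≡ false → HomTo𝟐 𝟐²⊕𝟏
  HomTo𝟐-by-exhaustion p h∧ h∨ h⇨ h⊤ h⊥ = record
    { ⟪_⟫   = p
    ; hom-∧ = by-exhaustion (λ x y → p (x ∧ y) ≟ᵇ p x && p y) h∧
    ; hom-∨ = by-exhaustion (λ x y → p (x ∨ y) ≟ᵇ p x || p y) h∨
    ; hom-⇨ = by-exhaustion (λ x y → p (x ⇨ y) ≟ᵇ not (p x) || p y) h⇨
    ; hom-⊤ = h⊤
    ; hom-⊥ = h⊥
    }

  -- Collapse the top two elements (giving 𝟐²) and project to one factor.
  π₁ π₂ : Five → Bool
  π₁ g0  = false
  π₁ ga  = true
  π₁ gna = false
  π₁ gc  = true
  π₁ g1  = true
  π₂ g0  = false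
  π₂ ga  = false
  π₂ gna = true
  π₂ gc  = true
  π₂ g1  = true

  π₁-hom π₂-hom : HomTo𝟐 𝟐²⊕𝟏
  π₁-hom = HomTo𝟐-by-exhaustion π₁ tt tt tt refl refl
  π₂-hom = HomTo𝟐-by-exhaustion π₂ tt tt tt refl refl

  ⟨_,_⟩ : Bool → Bool → Five
  ⟨ false , false ⟩ = g0
  ⟨ true  , false ⟩ = ga
  ⟨ false , true  ⟩ = gna
  ⟨ true  , true  ⟩ = g1

  π₁⟨,⟩ : ∀ x y → π₁ ⟨ x , y ⟩ ≡ x
  π₁⟨,⟩ false false = refl
  π₁⟨,⟩ true  false = refl
  π₁⟨,⟩ false true  = refl
  π₁⟨,⟩ true  true  = refl

  π₂⟨,⟩ : ∀ x y → π₂ ⟨ x , y ⟩ ≡ y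
  π₂⟨,⟩ false false = refl
  π₂⟨,⟩ true  false = refl
  π₂⟨,⟩ false true  = refl
  π₂⟨,⟩ true  true  = refl

  open Pseudocomplement 𝟐²⊕𝟏 using (Complemented)

  complemented⇒π₁≡π₂ : ∀ x → Complemented x → π₁ x ≡ π₂ x
  complemented⇒π₁≡π₂ g0 _ = refl
  complemented⇒π₁≡π₂ g1 _ = refl

  complemented-in-𝟐²⊕𝟏⇒constant : ∀ s → (∀ ρ → Complemented (⟦ 𝟐²⊕𝟏 ⟧ s ρ)) →
                                  ∀ b c → ⟦ s ⟧ᵇ b ≡ ⟦ s ⟧ᵇ c
  complemented-in-𝟐²⊕𝟏⇒constant s compl b c = begin
    ⟦ s ⟧ᵇ b                ≡⟨ sym (⟦⟧-hom π₁-hom s (λ i → π₁⟨,⟩ (b i) (c i))) ⟩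
    π₁ (⟦ 𝟐²⊕𝟏 ⟧ s ρ)      ≡⟨ complemented⇒π₁≡π₂ _ (compl ρ) ⟩
    π₂ (⟦ 𝟐²⊕𝟏 ⟧ s ρ)      ≡⟨ ⟦⟧-hom π₂-hom s (λ i → π₂⟨,⟩ (b i) (c i)) ⟩
    ⟦ s ⟧ᵇ c                ∎
    where
    open ≡-Reasoning
    ρ : ℕ → Five
    ρ i = ⟨ b i , c i ⟩

module _ {E : Equations} (φ : EmbedsIntoFree E 𝟐²) where
  open EmbedsIntoFree φ

  image-of-a-complemented : ∀ H → H ∈V E → ∀ ρ → Pseudocomplement.Complemented H (⟦ H ⟧ (f fa) ρ)
  image-of-a-complemented H H∈V ρ = begin
    ⊤                               ≈⟨ Eq.sym (f-⊤ H H∈V ρ) ⟩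
    ⟦ H ⟧ (f f1) ρ                  ≈⟨ f-∨ fa fna H H∈V ρ ⟩
    ⟦ H ⟧ (f fa) ρ ∨ ⟦ H ⟧ (f fna) ρ ≈⟨ ∨-cong Eq.refl ¬-image ⟩
    ⟦ H ⟧ (f fa) ρ ∨ (⟦ H ⟧ (f fa) ρ ⇨ ⊥) ∎
    where
    open HeytingAlgebra H
    open import Relation.Binary.Lattice.Properties.HeytingAlgebra H using (⇨-cong)
    open import Relation.Binary.Lattice.Properties.JoinSemilattice joinSemilattice using (∨-cong)
    open import Relation.Binary.Reasoning.PartialOrder poset
    ¬-image : ⟦ H ⟧ (f fna) ρ ≈ ⟦ H ⟧ (f fa) ρ ⇨ ⊥
    ¬-image = Eq.trans (f-⇨ fa f0 H H∈V ρ) (⇨-cong Eq.refl (f-⊥ H H∈V ρ))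

  tautology⇒image-of-a≈F-top : Tautology (f fa) → f fa ≈F[ E ] f f1
  tautology⇒image-of-a≈F-top taut H H∈V ρ =
    antisym (≤-trans (maximum _) (reflexive (Eq.sym (f-⊤ H H∈V ρ))))
            (≤-trans (reflexive (f-⊤ H H∈V ρ))
                   (complemented∧dense⇒⊤≤ (image-of-a-complemented H H∈V ρ) (glivenko (f fa) taut ρ)))
    where
    open HeytingAlgebra H renaming (trans to ≤-trans)
    open Pseudocomplement H
    open Glivenko H

  refutable⇒image-of-a≈F-bottom : Tautology (f fa ⇒ₜ ⊥ₜ) → f fa ≈F[ E ] f f0
  refutable⇒image-of-a≈F-bottom refut H H∈V ρ =
    antisym (≤-trans (dense-¬⇒≤⊥ (glivenko (f fa ⇒ₜ ⊥ₜ) refut ρ))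
                     (≤-trans (minimum _) (reflexive (Eq.sym (f-⊥ H H∈V ρ)))))
            (≤-trans (reflexive (f-⊥ H H∈V ρ)) (minimum _))
    where
    open HeytingAlgebra H renaming (trans to ≤-trans)
    open Pseudocomplement H
    open Glivenko H

lemma7p14 : (E : Equations) → 𝟐²⊕𝟏 ∈V E → ¬ EmbedsIntoFree E 𝟐²
lemma7p14 E 𝟐²⊕𝟏∈V φ =
  [ (λ taut  → a≢1 (f-inj (tautology⇒image-of-a≈F-top φ taut)))
  , (λ refut → a≢0 (f-inj (refutable⇒image-of-a≈F-bottom φ refut)))
  ]′ (constant⇒tautology⊎refutable (f fa)
       (complemented-in-𝟐²⊕𝟏⇒constant (f fa) (image-of-a-complemented φ 𝟐²⊕𝟏 𝟐²⊕𝟏∈V)))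
  where
  open EmbedsIntoFree φ
  a≢1 : fa ≢ f1
  a≢1 ()
  a≢0 : fa ≢ f0
  a≢0 ()
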